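{- Let $A$ be a nonempty set of integers and let $r$ be a positive integer such that $r_A(n) \leq r$ for all $n \in \mathbb{Z}$. Then $A(-x,x) \leq \sqrt{8rx}$ for all $x \geq r$.
   Context: For a set $A$ of integers, $r_A(n)$ denotes the number of pairs $(a,a') \in A \times A$ with $a \leq a'$ and $a + a' = n$. $A(-x,x)$ denotes the number of elements $a \in A$ with $-x \leq a \leq x$. -}

module Defs where

open import Data.Bool using (Bool; true; false; _∧_; if_then_else_)
open import Data.Nat using (ℕ; zero; suc)
open import Data.Integer as ℤ using (ℤ; +_; -_; _≤ᵇ_; _-_)
open import Data.List using (List; []; _∷_; applyUpTo; length; filterᵇ)
open import Data.Rational as ℚ using (ℚ)
open import Data.Product using (Σ)
open import Relation.Binary.PropositionalEquality using (_≡_)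

IntSet : Set
IntSet = ℤ → Bool

interval : ℕ → List ℤ
interval N = applyUpTo (λ i → + i - + N) (suc (N Data.Nat.+ N))

countIn : IntSet → ℕ → ℕ
countIn A N = length (filterᵇ A (interval N))

countUpTo : IntSet → ℚ → ℕ
countUpTo A x = countIn A ℤ.∣ ℚ.floor x ∣

-- Number of pairs (a, n - a) with a ≤ n - a, both in A, and a ∈ [-N, N].
-- Each representation n = a + a' with a ≤ a' is determined by a.
rWithin : IntSet → ℤ → ℕ → ℕ
rWithin A n N =
  length (filterᵇ (λ a → (a ≤ᵇ (n - a)) ∧ A a ∧ A (n - a)) (interval N))

rBounded : IntSet → ℤ → ℕ → Set
rBounded A n r = ∀ (N : ℕ) → rWithin A n N Data.Nat.≤ r

Nonempty : IntSet → Set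
Nonempty A = Σ ℤ (λ a → A a ≡ true)

{-# OPTIONS --safe #-}
-- Put k = A(-N, N) with N = ⌊x⌋ ≥ r. Of the pairs a ≤ a' of elements of A ∩ [-N, N] there are
-- at least k(k+1)/2. Each has its sum in [-2N, 2N], and each of these 4N+1 integers is such a
-- sum at most r times, so k(k+1) ≤ 2r(4N+1). If k ≥ 2r this gives k² ≤ 8rN; otherwise
-- k² ≤ 4r² ≤ 4rN. Finally 8rN ≤ 8rx.
module Submission where

open import Defs
open import Data.Nat as ℕ using (ℕ; NonZero)
open import Data.Integer using (+_)

module FiniteSums where

  open import Data.Bool using (Bool; true; false)
  open import Data.List using (List; []; _∷_; applyUpTo; length; filterᵇ)
  open import Data.List.Membership.Propositional using (_∈_)
  open import Data.List.Relation.Unary.Any using (here; there)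
  open import Data.Nat using (zero; suc; _+_; _*_; _≤_; z≤n; s≤s)
  import Data.Nat.Properties as ℕ
  open import Algebra.Properties.CommutativeSemigroup ℕ.+-commutativeSemigroup
    using (interchange; x∙yz≈y∙xz)
  open import Function using (_∘_)
  open import Relation.Binary.PropositionalEquality
    using (_≡_; refl; sym; trans; cong; cong₂; module ≡-Reasoning)

  private
    variable
      X Y : Set
      f g : X → ℕ

  ∑ : List X → (X → ℕ) → ℕ
  ∑ []       f = 0
  ∑ (x ∷ xs) f = f x + ∑ xs f

  syntax ∑ xs (λ x → e) = ∑[ x ∈ xs ] e

  iverson : Bool → ℕ
  iverson true  = 1
  iverson false = 0

  length-filterᵇ : ∀ (P : X → Bool) xs → length (filterᵇ P xs) ≡ ∑[ x ∈ xs ] iverson (P x)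
  length-filterᵇ P []       = refl
  length-filterᵇ P (x ∷ xs) with P x
  ... | true  = cong suc (length-filterᵇ P xs)
  ... | false = length-filterᵇ P xs

  ∑-cong : ∀ (xs : List X) → (∀ x → f x ≡ g x) → ∑ xs f ≡ ∑ xs g
  ∑-cong []       eq = refl
  ∑-cong (x ∷ xs) eq = cong₂ _+_ (eq x) (∑-cong xs eq)

  ∑-+ : ∀ (xs : List X) → ∑[ x ∈ xs ] (f x + g x) ≡ ∑ xs f + ∑ xs g
  ∑-+ []                   = refl
  ∑-+ {f = f} {g} (x ∷ xs) = begin
    f x + g x + ∑[ x ∈ xs ] (f x + g x) ≡⟨ cong (_+_ (f x + g x)) (∑-+ xs) ⟩
    f x + g x + (∑ xs f + ∑ xs g)       ≡⟨ interchange (f x) (g x) (∑ xs f) (∑ xs g) ⟩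
    f x + ∑ xs f + (g x + ∑ xs g)       ∎
    where open ≡-Reasoning

  ∑-*ʳ : ∀ (xs : List X) c → ∑[ x ∈ xs ] (f x * c) ≡ ∑ xs f * c
  ∑-*ʳ []               c = refl
  ∑-*ʳ {f = f} (x ∷ xs) c =
    trans (cong (_+_ (f x * c)) (∑-*ʳ xs c)) (sym (ℕ.*-distribʳ-+ c (f x) (∑ xs f)))

  ∑-comm : ∀ (xs : List X) (ys : List Y) (h : X → Y → ℕ) →
           ∑[ x ∈ xs ] ∑[ y ∈ ys ] h x y ≡ ∑[ y ∈ ys ] ∑[ x ∈ xs ] h x y
  ∑-comm []       ys h = sym (∑-zero ys)
    where
    ∑-zero : ∀ (ys : List Y) → ∑[ y ∈ ys ] 0 ≡ 0
    ∑-zero []       = refl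
    ∑-zero (y ∷ ys) = ∑-zero ys
  ∑-comm (x ∷ xs) ys h = trans (cong (_+_ (∑ ys (h x))) (∑-comm xs ys h)) (sym (∑-+ ys))

  ∑-mono : ∀ (xs : List X) → (∀ {x} → x ∈ xs → f x ≤ g x) → ∑ xs f ≤ ∑ xs g
  ∑-mono []       le = z≤n
  ∑-mono (x ∷ xs) le = ℕ.+-mono-≤ (le (here refl)) (∑-mono xs (le ∘ there))

  ∑-mono-excess : ∀ (xs : List X) {x e} → x ∈ xs →
                  (∀ {y} → y ∈ xs → f y ≤ g y) → e + f x ≤ g x → e + ∑ xs f ≤ ∑ xs g
  ∑-mono-excess {f = f} {g} (y ∷ xs) {e = e} (here refl) le le-x = begin
    e + (f y + ∑ xs f) ≡⟨ ℕ.+-assoc e (f y) (∑ xs f) ⟨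
    e + f y + ∑ xs f   ≤⟨ ℕ.+-mono-≤ le-x (∑-mono xs (le ∘ there)) ⟩
    g y + ∑ xs g       ∎
    where open ℕ.≤-Reasoning
  ∑-mono-excess {f = f} {g} (y ∷ xs) {e = e} (there x∈xs) le le-x = begin
    e + (f y + ∑ xs f) ≡⟨ x∙yz≈y∙xz e (f y) (∑ xs f) ⟩
    f y + (e + ∑ xs f)
      ≤⟨ ℕ.+-mono-≤ (le (here refl)) (∑-mono-excess xs x∈xs (le ∘ there) le-x) ⟩
    g y + ∑ xs g       ∎
    where open ℕ.≤-Reasoning

  ∑-≤-length* : ∀ (xs : List X) {c} → (∀ x → f x ≤ c) → ∑ xs f ≤ length xs * c
  ∑-≤-length* []       le = z≤n
  ∑-≤-length* (x ∷ xs) le = ℕ.+-mono-≤ (le x) (∑-≤-length* xs le)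

  ∑-applyUpTo-cong : ∀ {h h′ : ℕ → X} n → (∀ i → f (h i) ≡ g (h′ i)) →
                     ∑ (applyUpTo h n) f ≡ ∑ (applyUpTo h′ n) g
  ∑-applyUpTo-cong zero    eq = refl
  ∑-applyUpTo-cong (suc n) eq = cong₂ _+_ (eq 0) (∑-applyUpTo-cong n (eq ∘ suc))

  ∑-applyUpTo-infix : ∀ (h : ℕ → X) {i m n} → i + m ≤ n →
                      ∑ (applyUpTo (λ j → h (i + j)) m) f ≤ ∑ (applyUpTo h n) f
  ∑-applyUpTo-infix h {zero}  {zero}          _        = z≤n
  ∑-applyUpTo-infix h {zero}  {suc m} {suc n} (s≤s le) =
    ℕ.+-monoʳ-≤ _ (∑-applyUpTo-infix (h ∘ suc) {zero} le)
  ∑-applyUpTo-infix {f = f} h {suc i} {m} {suc n} (s≤s le) =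
    ℕ.≤-trans (∑-applyUpTo-infix (h ∘ suc) {i} {m} le) (ℕ.m≤n+m _ (f (h 0)))

module PairCounting where

  open FiniteSums
  open import Data.Bool using (Bool; true; false; T; _∧_)
  open import Data.Integer as ℤ using (ℤ; _-_; _≤ᵇ_)
  import Data.Integer.Properties as ℤ
  import Data.Integer.Tactic.RingSolver as ℤ-Solver
  open import Data.List using (List; applyUpTo; length; filterᵇ)
  open import Data.List.Membership.Propositional using (_∈_)
  open import Data.List.Membership.Propositional.Properties using (∈-applyUpTo⁻)
  open import Data.List.Properties using (length-applyUpTo)
  open import Data.Nat using (suc; _+_; _*_; _≤_; z≤n; s≤s)
  import Data.Nat.Properties as ℕ
  open import Data.Nat.Tactic.RingSolver using (solve-∀)
  open import Data.Product using (_,_)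
  open import Data.Sum using (_⊎_; inj₁; inj₂)
  open import Function using (_∘_)
  open import Relation.Binary.PropositionalEquality
    using (_≡_; refl; sym; trans; cong; cong₂; subst)

  pairIn : IntSet → ℤ → ℤ → Bool
  pairIn A a b = (a ≤ᵇ b) ∧ A a ∧ A b

  pairCount : IntSet → List ℤ → ℕ
  pairCount A xs = ∑[ a ∈ xs ] ∑[ b ∈ xs ] iverson (pairIn A a b)

  ≤ᵇ-total : ∀ a b → T (a ≤ᵇ b) ⊎ T (b ≤ᵇ a)
  ≤ᵇ-total a b with ℤ.≤-total a b
  ... | inj₁ a≤b = inj₁ (ℤ.≤⇒≤ᵇ a≤b)
  ... | inj₂ b≤a = inj₂ (ℤ.≤⇒≤ᵇ b≤a)

  pairIn-comparable : ∀ A a b →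
                      iverson (A b) * iverson (A a) ≤ iverson (pairIn A a b) + iverson (pairIn A b a)
  pairIn-comparable A a b with A b | A a
  ... | false | _     = z≤n
  ... | true  | false = z≤n
  ... | true  | true  with a ≤ᵇ b | b ≤ᵇ a | ≤ᵇ-total a b
  ...   | true  | _     | _        = s≤s z≤n
  ...   | false | true  | _        = s≤s z≤n
  ...   | false | false | inj₁ ()
  ...   | false | false | inj₂ ()

  pairIn-diagonal : ∀ A a → iverson (A a) + iverson (A a) * iverson (A a) ≤
                            iverson (pairIn A a a) + iverson (pairIn A a a)
  pairIn-diagonal A a with A a
  ... | false = z≤n
  ... | true  with a ≤ᵇ a | ℤ.≤⇒≤ᵇ (ℤ.≤-refl {a})
  ...   | true | _ = ℕ.≤-refl

  pairCount-lower : ∀ A xs → length (filterᵇ A xs) * suc (length (filterᵇ A xs)) ≤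
                             pairCount A xs + pairCount A xs
  pairCount-lower A xs = begin
    length (filterᵇ A xs) * suc (length (filterᵇ A xs))
      ≡⟨ cong (λ n → n * suc n) (length-filterᵇ A xs) ⟩
    k * suc k
      ≡⟨ ∑-*ʳ xs (suc k) ⟨
    ∑[ a ∈ xs ] (iverson (A a) * suc k)
      ≤⟨ ∑-mono xs row ⟩
    ∑[ a ∈ xs ] ∑[ b ∈ xs ] (pair a b + pair b a)
      ≡⟨ ∑-cong xs (λ a → ∑-+ xs) ⟩
    ∑[ a ∈ xs ] (∑[ b ∈ xs ] pair a b + ∑[ b ∈ xs ] pair b a)
      ≡⟨ ∑-+ xs ⟩
    pairCount A xs + ∑[ a ∈ xs ] ∑[ b ∈ xs ] pair b a
      ≡⟨ cong (_+_ (pairCount A xs)) (∑-comm xs xs (λ a b → pair b a)) ⟩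
    pairCount A xs + pairCount A xs ∎
    where
    open ℕ.≤-Reasoning
    k : ℕ
    k = ∑[ x ∈ xs ] iverson (A x)
    pair : ℤ → ℤ → ℕ
    pair a b = iverson (pairIn A a b)
    row : ∀ {a} → a ∈ xs → iverson (A a) * suc k ≤ ∑[ b ∈ xs ] (pair a b + pair b a)
    row {a} a∈xs = begin
      iverson (A a) * suc k
        ≡⟨ ℕ.*-comm (iverson (A a)) (suc k) ⟩
      iverson (A a) + k * iverson (A a)
        ≡⟨ cong (_+_ (iverson (A a))) (∑-*ʳ xs (iverson (A a))) ⟨
      iverson (A a) + ∑[ b ∈ xs ] (iverson (A b) * iverson (A a))
        ≤⟨ ∑-mono-excess xs a∈xs (λ {b} _ → pairIn-comparable A a b) (pairIn-diagonal A a) ⟩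
      ∑[ b ∈ xs ] (pair a b + pair b a) ∎

  ∑-interval-translate : ∀ {N a} (f : ℤ → ℕ) → a ∈ interval N →
                         ∑[ b ∈ interval N ] f (a ℤ.+ b) ≤ ∑[ n ∈ interval (N + N) ] f n
  ∑-interval-translate {N} f a∈I with ∈-applyUpTo⁻ (λ i → + i - + N) a∈I
  ... | i , s≤s i≤2N , refl = begin
    ∑[ b ∈ interval N ] f ((+ i - + N) ℤ.+ b)
      ≡⟨ ∑-applyUpTo-cong (suc (N + N)) (λ j → cong f (translate j)) ⟩
    ∑ (applyUpTo (λ j → + (i + j) - + (N + N)) (suc (N + N))) f
      ≤⟨ ∑-applyUpTo-infix (λ l → + l - + (N + N)) fits ⟩
    ∑[ n ∈ interval (N + N) ] f n ∎
    where
    open ℕ.≤-Reasoning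
    regroup : ∀ a b c → (a - c) ℤ.+ (b - c) ≡ (a ℤ.+ b) - (c ℤ.+ c)
    regroup = ℤ-Solver.solve-∀
    translate : ∀ j → (+ i - + N) ℤ.+ (+ j - + N) ≡ + (i + j) - + (N + N)
    translate j = trans (regroup (+ i) (+ j) (+ N)) (sym (cong₂ _-_ (ℤ.pos-+ i j) (ℤ.pos-+ N N)))
    fits : i + suc (N + N) ≤ suc ((N + N) + (N + N))
    fits = subst (_≤ suc ((N + N) + (N + N))) (sym (ℕ.+-suc i (N + N)))
                 (s≤s (ℕ.+-monoˡ-≤ (N + N) i≤2N))

  pairCount-upper : ∀ A {r} → (∀ n → rBounded A n r) → ∀ N →
                    pairCount A (interval N) ≤ length (interval (N + N)) * r
  pairCount-upper A {r} bounded N = begin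
    pairCount A I                         ≤⟨ ∑-mono I row ⟩
    ∑[ a ∈ I ] ∑[ n ∈ J ] pairWithSum n a ≡⟨ ∑-comm I J (λ a n → pairWithSum n a) ⟩
    ∑[ n ∈ J ] ∑[ a ∈ I ] pairWithSum n a ≡⟨ ∑-cong J (λ n → length-filterᵇ (withSum n) I) ⟨
    ∑[ n ∈ J ] rWithin A n N              ≤⟨ ∑-≤-length* J (λ n → bounded n N) ⟩
    length J * r                          ∎
    where
    open ℕ.≤-Reasoning
    I J : List ℤ
    I = interval N
    J = interval (N + N)
    withSum : ℤ → ℤ → Bool
    withSum n a = pairIn A a (n - a)
    pairWithSum : ℤ → ℤ → ℕ
    pairWithSum n a = iverson (withSum n a)
    cancel : ∀ a b → (a ℤ.+ b) - a ≡ b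
    cancel = ℤ-Solver.solve-∀
    row : ∀ {a} → a ∈ I → ∑[ b ∈ I ] iverson (pairIn A a b) ≤ ∑[ n ∈ J ] pairWithSum n a
    row {a} a∈I = begin
      ∑[ b ∈ I ] iverson (pairIn A a b)
        ≡⟨ ∑-cong I (λ b → cong (iverson ∘ pairIn A a) (cancel a b)) ⟨
      ∑[ b ∈ I ] pairWithSum (a ℤ.+ b) a
        ≤⟨ ∑-interval-translate {N} (λ n → pairWithSum n a) a∈I ⟩
      ∑[ n ∈ J ] pairWithSum n a ∎

  countIn-bound : ∀ A {r} → (∀ n → rBounded A n r) → ∀ N →
                  countIn A N * suc (countIn A N) ≤ 2 * (suc (4 * N) * r)
  countIn-bound A {r} bounded N = begin
    countIn A N * suc (countIn A N)
      ≤⟨ pairCount-lower A (interval N) ⟩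
    pairCount A (interval N) + pairCount A (interval N)
      ≤⟨ ℕ.+-mono-≤ (pairCount-upper A bounded N) (pairCount-upper A bounded N) ⟩
    length (interval (N + N)) * r + length (interval (N + N)) * r
      ≡⟨ cong (λ L → L * r + L * r) (length-applyUpTo (λ i → + i - + (N + N)) (suc 4N)) ⟩
    suc 4N * r + suc 4N * r
      ≡⟨ double r N ⟩
    2 * (suc (4 * N) * r) ∎
    where
    open ℕ.≤-Reasoning
    4N : ℕ
    4N = (N + N) + (N + N)
    double : ∀ r N → suc ((N + N) + (N + N)) * r + suc ((N + N) + (N + N)) * r
                     ≡ 2 * (suc (4 * N) * r)
    double = solve-∀

  k*k≤8*r*N : ∀ {k r N} → k * suc k ≤ 2 * (suc (4 * N) * r) → r ≤ N → k * k ≤ 8 * r * N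
  k*k≤8*r*N {k} {r} {N} bound r≤N with ℕ.≤-total k (2 * r)
  ... | inj₁ k≤2r = begin
    k * k           ≤⟨ ℕ.*-mono-≤ k≤2r k≤2r ⟩
    2 * r * (2 * r) ≤⟨ ℕ.*-monoʳ-≤ (2 * r) (ℕ.*-mono-≤ {2} {4} (s≤s (s≤s z≤n)) r≤N) ⟩
    2 * r * (4 * N) ≡⟨ regroup r N ⟩
    8 * r * N       ∎
    where
    open ℕ.≤-Reasoning
    regroup : ∀ r N → 2 * r * (4 * N) ≡ 8 * r * N
    regroup = solve-∀
  ... | inj₂ 2r≤k = ℕ.+-cancelˡ-≤ (2 * r) _ _ (begin
    2 * r + k * k         ≤⟨ ℕ.+-monoˡ-≤ (k * k) 2r≤k ⟩
    k + k * k             ≡⟨ ℕ.*-suc k k ⟨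
    k * suc k             ≤⟨ bound ⟩
    2 * (suc (4 * N) * r) ≡⟨ expand r N ⟩
    2 * r + 8 * r * N     ∎)
    where
    open ℕ.≤-Reasoning
    expand : ∀ r N → 2 * (suc (4 * N) * r) ≡ 2 * r + 8 * r * N
    expand = solve-∀

module FloorBound where

  open import Data.Integer as ℤ using (-[1+_]; +≤+)
  import Data.Integer.Properties as ℤ
  open import Data.Integer.DivMod using (div-pos-is-/ℕ)
  open import Data.Nat using (suc; _*_; _≤_)
  open import Data.Nat.Coprimality as Coprimality using (Coprime; 1-coprimeTo)
  open import Data.Nat.DivMod using (_/_; m/n*n≤m; m*n/n≡m; /-monoˡ-≤)
  import Data.Nat.Properties as ℕ
  open import Data.Rational as ℚ using (ℚ; mkℚ; *≤*; floor)
  import Data.Rational.Properties as ℚ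
  import Data.Rational.Unnormalised as ℚᵘ
  import Data.Rational.Unnormalised.Properties as ℚᵘ
  open import Relation.Binary.PropositionalEquality
    using (_≡_; sym; trans; cong; subst; subst₂)

  +m/1≡mkℚ : ∀ m → + m ℚ./ 1 ≡ mkℚ (+ m) 0 (Coprimality.sym (1-coprimeTo m))
  +m/1≡mkℚ m = ℚ.normalize-coprime (Coprimality.sym (1-coprimeTo m))

  /1≤mkℚ⇒ : ∀ m {n d} .{c : Coprime ℤ.∣ n ∣ (suc d)} →
            + m ℚ./ 1 ℚ.≤ mkℚ n d c → + (m * suc d) ℤ.≤ n
  /1≤mkℚ⇒ m {n} {d} {c} le with subst (ℚ._≤ mkℚ n d c) (+m/1≡mkℚ m) le
  ... | *≤* cross = subst₂ ℤ._≤_ (sym (ℤ.pos-* m (suc d))) (ℤ.*-identityʳ n) cross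

  /1≤/1*mkℚ : ∀ m c {p d} .{cop : Coprime p (suc d)} → m * suc d ≤ c * p →
              + m ℚ./ 1 ℚ.≤ (+ c ℚ./ 1) ℚ.* mkℚ (+ p) d cop
  /1≤/1*mkℚ m c {p} {d} {cop} le rewrite +m/1≡mkℚ m | +m/1≡mkℚ c =
    ℚ.toℚᵘ-cancel-≤ (ℚᵘ.≤-respʳ-≃ (ℚᵘ.≃-sym (ℚ.toℚᵘ-homo-* c/1 (mkℚ (+ p) d cop)))
                                  (ℚᵘ.*≤* cross))
    where
    c/1 : ℚ
    c/1 = mkℚ (+ c) 0 (Coprimality.sym (1-coprimeTo c))
    cross : + m ℤ.* + (1 * suc d) ℤ.≤ (+ c ℤ.* + p) ℤ.* + 1
    cross = subst₂ ℤ._≤_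
      (trans (ℤ.pos-* m (suc d)) (cong (λ e → + m ℤ.* + e) (sym (ℕ.*-identityˡ (suc d)))))
      (trans (ℤ.pos-* c p) (sym (ℤ.*-identityʳ _)))
      (+≤+ le)

  ∣floor-mkℚ∣ : ∀ p d .{c : Coprime p (suc d)} → ℤ.∣ floor (mkℚ (+ p) d c) ∣ ≡ p / suc d
  ∣floor-mkℚ∣ p d = cong ℤ.∣_∣ (div-pos-is-/ℕ (+ p) (suc d))

  linear-bound-at-floor : ∀ (h : ℕ → ℕ) c r → (∀ {N} → r ≤ N → h N ≤ c * N) →
                          ∀ x → + r ℚ./ 1 ℚ.≤ x →
                          + h ℤ.∣ floor x ∣ ℚ./ 1 ℚ.≤ (+ c ℚ./ 1) ℚ.* x
  linear-bound-at-floor h c r bound (mkℚ -[1+ n ] d _) r≤x with () ← /1≤mkℚ⇒ r r≤x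
  linear-bound-at-floor h c r bound (mkℚ (+ p) d cop) r≤x rewrite ∣floor-mkℚ∣ p d {cop} =
    /1≤/1*mkℚ (h N) c (begin
      h N * suc d     ≤⟨ ℕ.*-monoˡ-≤ (suc d) (bound r≤N) ⟩
      c * N * suc d   ≡⟨ ℕ.*-assoc c N (suc d) ⟩
      c * (N * suc d) ≤⟨ ℕ.*-monoʳ-≤ c (m/n*n≤m p (suc d)) ⟩
      c * p           ∎)
    where
    open ℕ.≤-Reasoning
    N : ℕ
    N = p / suc d
    r≤N : r ≤ N
    r≤N = subst (_≤ N) (m*n/n≡m r (suc d))
                (/-monoˡ-≤ (suc d) (ℤ.drop‿+≤+ (/1≤mkℚ⇒ r r≤x)))

open import Data.Rational using (ℚ; _≤_; _*_; _/_)
open PairCounting using (countIn-bound; k*k≤8*r*N)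
open FloorBound using (linear-bound-at-floor)

theorem3 : (A : IntSet) → Nonempty A → (r : ℕ) → .{{_ : NonZero r}} →
           (∀ n → rBounded A n r) →
           (x : ℚ) → (+ r / 1) ≤ x →
           (+ (countUpTo A x ℕ.* countUpTo A x) / 1) ≤ ((+ (8 ℕ.* r) / 1) * x)
theorem3 A _ r bounded =
  linear-bound-at-floor (λ N → countIn A N ℕ.* countIn A N) (8 ℕ.* r) r
    (λ {N} r≤N → k*k≤8*r*N {countIn A N} (countIn-bound A bounded N) r≤N)
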